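{- If $A,B$ are almost well-ordered (with $B\subset A$ carrying the order induced from a linear order $\leq$ on $A$), then the canonical order $\leq_{can}$ on $A\times B$ is an almost well-order.
   Context: Framework: object generators (primitive collections), a two-element generator $\{\textsf{yes},\textsf{no}\}$, binary functions; a (relaxed) set is a logical domain (generator with binary equality pairing) with a binary function on its powerset detecting the constantly-$\textsf{no}$ function. A linear order is a transitive total binary pairing $\leq$ with $(a\leq b$ and $b\leq a)$ iff $a,b$ are the same; it is a well-order if the domain is a set and every downward-closed binary subdomain is everything or an initial segment $(\#<b)=\{a:a<b\}$, and an almost well-order if every $(\#<x)$ is well-ordered. For a linear order $(A,\leq)$ and subdomain $B\subset A$, the canonical order on $A\times B$: $(a_1,b_1)<_{can}(a_2,b_2)$ means $\max[a_1,b_1]<\max[a_2,b_2]$, or $\max[a_1,b_1]=\max[a_2,b_2]$ and ($a_1<a_2$, or $a_1=a_2$ and $b_1<b_2$). (Equivalently, among pairs with maximum $c$, those of form $(\#<c,c)$ precede those of form $(c,\#\leq c)$, each ordered as in $A$.) -}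

module Defs where

open import Data.Bool using (Bool; true; false; _∧_; _∨_; not; if_then_else_)
open import Data.Bool.Properties using () renaming (_≟_ to _≟B_)
open import Data.Product using (Σ; ∃; _×_; _,_; proj₁; proj₂)
open import Data.Sum using (_⊎_)
open import Function.Bundles using (_⇔_)
open import Relation.Nullary using (yes; no; ⌊_⌋)
open import Relation.Binary.Definitions using (DecidableEquality)
open import Relation.Binary.PropositionalEquality using (_≡_; refl; cong)
open import Axiom.UniquenessOfIdentityProofs using (module Decidable⇒UIP)

-- A logical domain: a type with a binary (decidable) equality pairing.
-- Binary relations / subdomains are Bool-valued (yes = true, no = false).

record IsLinearOrder {X : Set} (_≤_ : X → X → Bool) : Set where
  field
    trans : ∀ a b c → (a ≤ b) ≡ true → (b ≤ c) ≡ true → (a ≤ c) ≡ true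
    total : ∀ a b → ((a ≤ b) ≡ true) ⊎ ((b ≤ a) ≡ true)
    antisym : ∀ a b → (((a ≤ b) ≡ true) × ((b ≤ a) ≡ true)) ⇔ (a ≡ b)

IsRelaxedSet : Set → Set
IsRelaxedSet X = Σ ((X → Bool) → Bool) λ test →
  ∀ (f : X → Bool) → (test f ≡ true) ⇔ (∀ x → f x ≡ false)

strict : {X : Set} → DecidableEquality X → (X → X → Bool) → X → X → Bool
strict _≟_ _≤_ a b = (a ≤ b) ∧ not ⌊ a ≟ b ⌋

Sub : (X : Set) → (X → Bool) → Set
Sub X P = Σ X λ x → P x ≡ true

subDecEq : {X : Set} → DecidableEquality X → (P : X → Bool) → DecidableEquality (Sub X P)
subDecEq _≟_ P (a , p) (b , q) with a ≟ b
... | yes refl = yes (cong (a ,_) (Decidable⇒UIP.≡-irrelevant _≟B_ p q))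
... | no a≢b = no λ { refl → a≢b refl }

induced : {X : Set} → (X → X → Bool) → (P : X → Bool) → Sub X P → Sub X P → Bool
induced _≤_ P u v = proj₁ u ≤ proj₁ v

Seg : {X : Set} → DecidableEquality X → (X → X → Bool) → X → Set
Seg {X} _≟_ _≤_ b = Sub X (λ a → strict _≟_ _≤_ a b)

DownClosed : {X : Set} → (X → X → Bool) → (X → Bool) → Set
DownClosed {X} _≤_ D = ∀ (a b : X) → D b ≡ true → (a ≤ b) ≡ true → D a ≡ true

IsWellOrder : (X : Set) → DecidableEquality X → (X → X → Bool) → Set
IsWellOrder X _≟_ _≤_ =
  IsLinearOrder _≤_ × IsRelaxedSet X ×
  (∀ (D : X → Bool) → DownClosed _≤_ D →
     (∀ a → D a ≡ true) ⊎ (∃ λ b → ∀ a → D a ≡ strict _≟_ _≤_ a b))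

IsAlmostWellOrder : (X : Set) → DecidableEquality X → (X → X → Bool) → Set
IsAlmostWellOrder X _≟_ _≤_ =
  IsLinearOrder _≤_ ×
  (∀ (x : X) → IsWellOrder (Seg _≟_ _≤_ x)
                 (subDecEq _≟_ (λ a → strict _≟_ _≤_ a x))
                 (induced _≤_ (λ a → strict _≟_ _≤_ a x)))

maxOf : {X : Set} → (X → X → Bool) → X → X → X
maxOf _≤_ a b = if a ≤ b then b else a

prodDecEq : {X : Set} → DecidableEquality X → (P : X → Bool) → DecidableEquality (X × Sub X P)
prodDecEq _≟_ P (a₁ , b₁) (a₂ , b₂) with a₁ ≟ a₂ | subDecEq _≟_ P b₁ b₂
... | yes refl | yes refl = yes refl
... | no ne | _ = no λ { refl → ne refl }
... | yes _ | no ne = no λ { refl → ne refl }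

canLt : {X : Set} → DecidableEquality X → (X → X → Bool) → (P : X → Bool) →
        X × Sub X P → X × Sub X P → Bool
canLt _≟_ _≤_ P (a₁ , b₁) (a₂ , b₂) =
  let _<_ = strict _≟_ _≤_
      m₁ = maxOf _≤_ a₁ (proj₁ b₁)
      m₂ = maxOf _≤_ a₂ (proj₁ b₂)
  in (m₁ < m₂) ∨ (⌊ m₁ ≟ m₂ ⌋ ∧ ((a₁ < a₂) ∨ (⌊ a₁ ≟ a₂ ⌋ ∧ (proj₁ b₁ < proj₁ b₂))))

canLe : {X : Set} → DecidableEquality X → (X → X → Bool) → (P : X → Bool) →
        X × Sub X P → X × Sub X P → Bool
canLe _≟_ _≤_ P p q = canLt _≟_ _≤_ P p q ∨ ⌊ prodDecEq _≟_ P p q ⌋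

{-# OPTIONS --safe #-}
module Submission where

-- Write m(a, b) for max[a, b].  Sending (a, b) to the triple (m(a, b), a, b)
-- is injective and turns the canonical order into the lexicographic order on
-- A × A × A, so the canonical order is linear.  For well-foundedness, every
-- pair below (a, b) is sent into the cube [#≤ m(a, b)]³, each side of which is
-- well-ordered (the segment (#<m) together with m itself); least elements
-- exist in lexicographic products of well-orders, and are pulled back along the
-- injection and restricted to the initial segment.  Since B ⊂ A, this never
-- uses that B itself is almost well-ordered.

open import Defs
open import Axiom.UniquenessOfIdentityProofs using (UIP; module Decidable⇒UIP)
open import Data.Bool using (Bool; true; false; _∧_; _∨_; not)
open import Data.Bool.Properties
  using (∧-zeroʳ; ∨-zeroʳ; ∧-identityʳ; ∨-identityʳ; ∧-conicalˡ; ∧-conicalʳ; not-injective)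
  renaming (_≟_ to _≟B_)
open import Data.Product using (∃; _×_; _,_; proj₁; proj₂)
open import Data.Sum using (_⊎_; inj₁; inj₂; [_,_]′; map₁; map₂)
open import Data.Unit using (tt)
open import Function.Base using (_∘_; _on_; case_of_)
open import Function.Bundles using (_⇔_; mk⇔; Equivalence)
open import Function.Definitions using (Injective)
open import Relation.Binary.Definitions using (DecidableEquality)
open import Relation.Binary.PropositionalEquality
open import Relation.Nullary using (Dec; yes; no; ⌊_⌋; ¬_; contradiction)
open import Relation.Nullary.Decidable using (dec-yes-irr; toSum)
open import Relation.Unary using (U; _⟨×⟩_)

private
  variable
    X Y : Set

true≢false : true ≢ false
true≢false ()

Bool-UIP : UIP Bool
Bool-UIP = Decidable⇒UIP.≡-irrelevant _≟B_

true⇔true⇒≡ : ∀ {x y} → (x ≡ true → y ≡ true) → (y ≡ true → x ≡ true) → x ≡ y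
true⇔true⇒≡ {true}          x⇒y _ = sym (x⇒y refl)
true⇔true⇒≡ {false} {true}  _ y⇒x = y⇒x refl
true⇔true⇒≡ {false} {false} _ _   = refl

∨-true : ∀ x {y} → x ∨ y ≡ true → x ≡ true ⊎ y ≡ true
∨-true true  _ = inj₁ refl
∨-true false h = inj₂ h

∨-trueˡ : ∀ {x} y → x ≡ true → x ∨ y ≡ true
∨-trueˡ _ refl = refl

∨-trueʳ : ∀ x {y} → y ≡ true → x ∨ y ≡ true
∨-trueʳ x refl = ∨-zeroʳ x

∧-true : ∀ {x y} → x ≡ true → y ≡ true → x ∧ y ≡ true
∧-true refl refl = refl

is-inj₁ : {A B : Set} → A ⊎ B → Bool
is-inj₁ (inj₁ _) = true
is-inj₁ (inj₂ _) = false

is-inj₁-true : {A B : Set} (s : A ⊎ B) → is-inj₁ s ≡ true → A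
is-inj₁-true (inj₁ a) _ = a

is-inj₁-false : {A B : Set} (s : A ⊎ B) → is-inj₁ s ≡ false → B
is-inj₁-false (inj₂ b) _ = b

⌊⌋-true : {A : Set} (a? : Dec A) → A → ⌊ a? ⌋ ≡ true
⌊⌋-true (yes _) _ = refl
⌊⌋-true (no ¬a) a = contradiction a ¬a

⌊⌋-false : {A : Set} (a? : Dec A) → ¬ A → ⌊ a? ⌋ ≡ false
⌊⌋-false (yes a) ¬a = contradiction a ¬a
⌊⌋-false (no _)  _  = refl

⌊⌋-true⁻¹ : {A : Set} (a? : Dec A) → ⌊ a? ⌋ ≡ true → A
⌊⌋-true⁻¹ (yes a) _ = a

⌊⌋-⇔ : {A B : Set} → A ⇔ B → (a? : Dec A) (b? : Dec B) → ⌊ a? ⌋ ≡ ⌊ b? ⌋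
⌊⌋-⇔ A⇔B a? (yes b) = ⌊⌋-true a? (Equivalence.from A⇔B b)
⌊⌋-⇔ A⇔B a? (no ¬b) = ⌊⌋-false a? (¬b ∘ Equivalence.to A⇔B)

Sub-≡ : {P : X → Bool} {u v : Sub X P} → proj₁ u ≡ proj₁ v → u ≡ v
Sub-≡ {u = x , p} {v = .x , q} refl = cong (x ,_) (Bool-UIP p q)

extend : (P : X → Bool) → (Sub X P → Bool) → X → Bool
extend P R x = [ R ∘ (x ,_) , (λ _ → false) ]′ (toSum (P x ≟B true))

extend-≡ : (P : X → Bool) (R : Sub X P → Bool) {x : X} (Px : P x ≡ true) → extend P R x ≡ R (x , Px)
extend-≡ P R {x} Px =
  cong (λ d → [ R ∘ (x ,_) , (λ _ → false) ]′ (toSum d)) (dec-yes-irr (P x ≟B true) Bool-UIP Px)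

strict-induced : (_≟_ : DecidableEquality X) (_≤_ : X → X → Bool) (P : X → Bool) (u v : Sub X P) →
  strict (subDecEq _≟_ P) (induced _≤_ P) u v ≡ (strict _≟_ _≤_ on proj₁) u v
strict-induced _≟_ _≤_ P u v =
  cong (λ d → (proj₁ u ≤ proj₁ v) ∧ not d) (⌊⌋-⇔ (mk⇔ (cong proj₁) Sub-≡) (subDecEq _≟_ P u v) _)

induced-isLinearOrder : {_≤_ : X → X → Bool} → IsLinearOrder _≤_ → (P : X → Bool) →
  IsLinearOrder (induced _≤_ P)
induced-isLinearOrder lo P = record
  { trans   = λ u v w → ≤-trans (proj₁ u) (proj₁ v) (proj₁ w)
  ; total   = λ u v → total (proj₁ u) (proj₁ v)
  ; antisym = λ u v → mk⇔ (Sub-≡ ∘ Equivalence.to (antisym _ _))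
                           (Equivalence.from (antisym _ _) ∘ cong proj₁)
  }
  where open IsLinearOrder lo renaming (trans to ≤-trans)

-- Least elements

FalseOn : (X → Set) → (X → Bool) → Set
FalseOn In R = ∀ x → In x → R x ≡ false

MinimalIn : (X → X → Bool) → (X → Set) → (X → Bool) → X → Set
MinimalIn _<_ In R x = In x × R x ≡ true × (∀ y → In y → y < x ≡ true → R y ≡ false)

HasLeast : (X → X → Bool) → (X → Set) → Set
HasLeast _<_ In = ∀ R → FalseOn In R ⊎ ∃ (MinimalIn _<_ In R)

hasLeast-resp : {_<_ _<′_ : X → X → Bool} {In : X → Set} →
  (∀ a b → a < b ≡ a <′ b) → HasLeast _<_ In → HasLeast _<′_ In
hasLeast-resp <≗<′ least R with least R
... | inj₁ none                       = inj₁ none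
... | inj₂ (x , Inx , Rx , minimal) = inj₂ (x , Inx , Rx , λ y Iny y<x → minimal y Iny (trans (<≗<′ y x) y<x))

hasLeast-⊆ : {_<_ : X → X → Bool} {In : X → Set} (P : X → Bool) →
  (∀ x → P x ≡ true → In x) → HasLeast _<_ In → HasLeast _<_ (λ x → P x ≡ true)
hasLeast-⊆ P P⊆In least R with least (λ x → P x ∧ R x)
... | inj₁ none = inj₁ λ x Px → subst (λ b → b ∧ R x ≡ false) Px (none x (P⊆In x Px))
... | inj₂ (x , _ , PRx , minimal) = inj₂ (x , ∧-conicalˡ _ _ PRx , ∧-conicalʳ _ _ PRx ,
        λ y Py y<x → subst (λ b → b ∧ R y ≡ false) Py (minimal y (P⊆In y Py) y<x))

hasLeast-on : {_<_ : Y → Y → Bool} {In : Y → Set} (f : X → Y) → Injective _≡_ _≡_ f →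
  (∀ y → Dec (∃ λ x → f x ≡ y)) → HasLeast _<_ In → HasLeast (_<_ on f) (In ∘ f)
hasLeast-on {_<_ = _<_} {In = In} f f-injective image? least R = pull (least (R′ ∘ image?))
  where
  R′ : ∀ {y} → Dec (∃ λ x → f x ≡ y) → Bool
  R′ (yes (x , _)) = R x
  R′ (no _)        = false

  R′-f : ∀ x → R′ (image? (f x)) ≡ R x
  R′-f x with image? (f x)
  ... | yes (_ , fx′≡fx) = cong R (f-injective fx′≡fx)
  ... | no ∄             = contradiction (x , refl) ∄

  R′-true : ∀ y → R′ (image? y) ≡ true → ∃ λ x → f x ≡ y × R x ≡ true
  R′-true y R′y with image? y
  ... | yes (x , fx≡y) = x , fx≡y , R′y
  ... | no _           = contradiction R′y λ ()

  pull : FalseOn In (R′ ∘ image?) ⊎ ∃ (MinimalIn _<_ In (R′ ∘ image?)) →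
         FalseOn (In ∘ f) R ⊎ ∃ (MinimalIn (_<_ on f) (In ∘ f) R)
  pull (inj₁ none) = inj₁ λ x Infx → trans (sym (R′-f x)) (none (f x) Infx)
  pull (inj₂ (y , Iny , R′y , minimal)) with R′-true y R′y
  ... | x , refl , Rx = inj₂ (x , Iny , Rx ,
          λ x′ Infx′ fx′<fx → trans (sym (R′-f x′)) (minimal (f x′) Infx′ fx′<fx))

hasLeast-fromSub : {_<_ : X → X → Bool} {P : X → Bool} →
  HasLeast {X = Sub X P} (_<_ on proj₁) U → HasLeast _<_ (λ x → P x ≡ true)
hasLeast-fromSub least R with least (R ∘ proj₁)
... | inj₁ none                          = inj₁ λ x Px → none (x , Px) tt
... | inj₂ ((x , Px) , _ , Rx , minimal) = inj₂ (x , Px , Rx , λ y Py → minimal (y , Py) tt)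

hasLeast-toSub : {_<_ : X → X → Bool} {P : X → Bool} →
  HasLeast _<_ (λ x → P x ≡ true) → HasLeast {X = Sub X P} (_<_ on proj₁) U
hasLeast-toSub {P = P} least R with least (extend P R)
... | inj₁ none = inj₁ λ { (x , Px) _ → trans (sym (extend-≡ P R Px)) (none x Px) }
... | inj₂ (x , Px , Rx , minimal) = inj₂ ((x , Px) , tt , trans (sym (extend-≡ P R Px)) Rx ,
        λ { (y , Py) _ y<x → trans (sym (extend-≡ P R Py)) (minimal y Py y<x) })

-- Strict total orders

record IsStrictTotal (_<_ : X → X → Bool) : Set where
  field
    irrefl       : ∀ a → a < a ≡ false
    transitive   : ∀ {a b c} → a < b ≡ true → b < c ≡ true → a < c ≡ true
    trichotomous : ∀ a b → a < b ≡ true ⊎ a ≡ b ⊎ b < a ≡ true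

reflClosure : DecidableEquality X → (X → X → Bool) → X → X → Bool
reflClosure _≟_ _<_ a b = a < b ∨ ⌊ a ≟ b ⌋

module ReflClosure (_≟_ : DecidableEquality X) {_<_ : X → X → Bool} (st : IsStrictTotal _<_) where
  open IsStrictTotal st

  _≤_ : X → X → Bool
  _≤_ = reflClosure _≟_ _<_

  <⇒≤ : ∀ {a b} → a < b ≡ true → a ≤ b ≡ true
  <⇒≤ = ∨-trueˡ _

  ≡⇒≤ : ∀ {a b} → a ≡ b → a ≤ b ≡ true
  ≡⇒≤ {a} refl = ∨-trueʳ (a < a) (⌊⌋-true (a ≟ a) refl)

  ≤⇒<⊎≡ : ∀ {a b} → a ≤ b ≡ true → a < b ≡ true ⊎ a ≡ b
  ≤⇒<⊎≡ {a} {b} = map₂ (⌊⌋-true⁻¹ (a ≟ b)) ∘ ∨-true (a < b)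

  strict-≤ : ∀ a b → strict _≟_ _≤_ a b ≡ a < b
  strict-≤ a b with a ≟ b
  ... | yes refl = trans (∧-zeroʳ _) (sym (irrefl a))
  ... | no _     = trans (∧-identityʳ _) (∨-identityʳ _)

  isLinearOrder : IsLinearOrder _≤_
  isLinearOrder = record
    { trans   = λ _ _ _ → ≤-trans
    ; total   = ≤-total
    ; antisym = λ _ _ → mk⇔ ≤-antisym λ { refl → ≡⇒≤ refl , ≡⇒≤ refl }
    }
    where
    ≤-trans : ∀ {a b c} → a ≤ b ≡ true → b ≤ c ≡ true → a ≤ c ≡ true
    ≤-trans a≤b b≤c with ≤⇒<⊎≡ a≤b | ≤⇒<⊎≡ b≤c
    ... | inj₁ a<b  | inj₁ b<c  = <⇒≤ (transitive a<b b<c)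
    ... | inj₁ _    | inj₂ refl = a≤b
    ... | inj₂ refl | _         = b≤c

    ≤-total : ∀ a b → a ≤ b ≡ true ⊎ b ≤ a ≡ true
    ≤-total a b with trichotomous a b
    ... | inj₁ a<b        = inj₁ (<⇒≤ a<b)
    ... | inj₂ (inj₁ a≡b) = inj₁ (≡⇒≤ a≡b)
    ... | inj₂ (inj₂ b<a) = inj₂ (<⇒≤ b<a)

    ≤-antisym : ∀ {a b} → a ≤ b ≡ true × b ≤ a ≡ true → a ≡ b
    ≤-antisym (a≤b , b≤a) with ≤⇒<⊎≡ a≤b | ≤⇒<⊎≡ b≤a
    ... | inj₂ a≡b | _        = a≡b
    ... | inj₁ _   | inj₂ b≡a = sym b≡a
    ... | inj₁ a<b | inj₁ b<a = contradiction (trans (sym (transitive a<b b<a)) (irrefl _)) true≢false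

on-isStrictTotal : {_<_ : Y → Y → Bool} (f : X → Y) → Injective _≡_ _≡_ f →
  IsStrictTotal _<_ → IsStrictTotal (_<_ on f)
on-isStrictTotal f f-injective st = record
  { irrefl       = irrefl ∘ f
  ; transitive   = transitive
  ; trichotomous = λ a b → map₂ (map₁ f-injective) (trichotomous (f a) (f b))
  }
  where open IsStrictTotal st

lex : DecidableEquality X → (X → X → Bool) → (Y → Y → Bool) → X × Y → X × Y → Bool
lex _≟_ _<₁_ _<₂_ (x₁ , y₁) (x₂ , y₂) = x₁ <₁ x₂ ∨ (⌊ x₁ ≟ x₂ ⌋ ∧ y₁ <₂ y₂)

module Lex (_≟_ : DecidableEquality X) (_<₁_ : X → X → Bool) (_<₂_ : Y → Y → Bool) where
  _<_ : X × Y → X × Y → Bool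
  _<_ = lex _≟_ _<₁_ _<₂_

  lex-cases : ∀ p q → p < q ≡ true →
    proj₁ p <₁ proj₁ q ≡ true ⊎ proj₁ p ≡ proj₁ q × proj₂ p <₂ proj₂ q ≡ true
  lex-cases (x₁ , _) (x₂ , _) =
    map₂ (λ h → ⌊⌋-true⁻¹ (x₁ ≟ x₂) (∧-conicalˡ _ _ h) , ∧-conicalʳ _ _ h) ∘ ∨-true (x₁ <₁ x₂)

  lex-<₁ : ∀ {x₁ x₂ y₁ y₂} → x₁ <₁ x₂ ≡ true → (x₁ , y₁) < (x₂ , y₂) ≡ true
  lex-<₁ = ∨-trueˡ _

  lex-<₂ : ∀ {x y₁ y₂} → y₁ <₂ y₂ ≡ true → (x , y₁) < (x , y₂) ≡ true
  lex-<₂ {x} y₁<y₂ = ∨-trueʳ (x <₁ x) (∧-true (⌊⌋-true (x ≟ x) refl) y₁<y₂)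

  lex-isStrictTotal : IsStrictTotal _<₁_ → IsStrictTotal _<₂_ → IsStrictTotal _<_
  lex-isStrictTotal st₁ st₂ = record
    { irrefl = <-irrefl ; transitive = <-trans ; trichotomous = <-trichotomous }
    where
    module S₁ = IsStrictTotal st₁
    module S₂ = IsStrictTotal st₂

    <-irrefl : ∀ p → p < p ≡ false
    <-irrefl (x , y) rewrite S₁.irrefl x | ⌊⌋-true (x ≟ x) refl = S₂.irrefl y

    <-trans : ∀ {p q r} → p < q ≡ true → q < r ≡ true → p < r ≡ true
    <-trans {p} {q} {r} p<q q<r with lex-cases p q p<q | lex-cases q r q<r
    ... | inj₁ x₁<x₂        | inj₁ x₂<x₃        = lex-<₁ (S₁.transitive x₁<x₂ x₂<x₃)
    ... | inj₁ x₁<x₂        | inj₂ (refl , _)   = lex-<₁ x₁<x₂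
    ... | inj₂ (refl , _)   | inj₁ x₂<x₃        = lex-<₁ x₂<x₃
    ... | inj₂ (refl , y₁<y₂) | inj₂ (refl , y₂<y₃) = lex-<₂ (S₂.transitive y₁<y₂ y₂<y₃)

    <-trichotomous : ∀ p q → p < q ≡ true ⊎ p ≡ q ⊎ q < p ≡ true
    <-trichotomous (x₁ , y₁) (x₂ , y₂) with S₁.trichotomous x₁ x₂
    ... | inj₁ x₁<x₂        = inj₁ (lex-<₁ x₁<x₂)
    ... | inj₂ (inj₂ x₂<x₁) = inj₂ (inj₂ (lex-<₁ x₂<x₁))
    ... | inj₂ (inj₁ refl) with S₂.trichotomous y₁ y₂
    ...   | inj₁ y₁<y₂        = inj₁ (lex-<₂ y₁<y₂)
    ...   | inj₂ (inj₁ refl)  = inj₂ (inj₁ refl)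
    ...   | inj₂ (inj₂ y₂<y₁) = inj₂ (inj₂ (lex-<₂ y₂<y₁))


  hasLeast-lex : {In₁ : X → Set} {In₂ : Y → Set} →
    HasLeast _<₁_ In₁ → HasLeast _<₂_ In₂ → HasLeast _<_ (In₁ ⟨×⟩ In₂)
  hasLeast-lex {In₁ = In₁} {In₂} least₁ least₂ R = combine (least₁ (not ∘ emptyFibre))
    where
    fibre : ∀ x → FalseOn In₂ (R ∘ (x ,_)) ⊎ ∃ (MinimalIn _<₂_ In₂ (R ∘ (x ,_)))
    fibre x = least₂ (R ∘ (x ,_))

    emptyFibre : X → Bool
    emptyFibre = is-inj₁ ∘ fibre

    combine : FalseOn In₁ (not ∘ emptyFibre) ⊎ ∃ (MinimalIn _<₁_ In₁ (not ∘ emptyFibre)) →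
              FalseOn (In₁ ⟨×⟩ In₂) R ⊎ ∃ (MinimalIn _<_ (In₁ ⟨×⟩ In₂) R)
    combine (inj₁ none) =
      inj₁ λ { (x , y) (In₁x , In₂y) → is-inj₁-true (fibre x) (not-injective (none x In₁x)) y In₂y }
    combine (inj₂ (x , In₁x , occupied , minimal₁))
      with is-inj₁-false (fibre x) (not-injective occupied)
    ... | y , In₂y , Rxy , minimal₂ = inj₂ ((x , y) , (In₁x , In₂y) , Rxy , minimal)
      where
      minimal : ∀ p → (In₁ ⟨×⟩ In₂) p → p < (x , y) ≡ true → R p ≡ false
      minimal (x′ , y′) (In₁x′ , In₂y′) p<xy with lex-cases (x′ , y′) (x , y) p<xy
      ... | inj₁ x′<x = is-inj₁-true (fibre x′) (not-injective (minimal₁ x′ In₁x′ x′<x)) y′ In₂y′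
      ... | inj₂ (refl , y′<y) = minimal₂ y′ In₂y′ y′<y

-- Linear orders and well-orders

module LinearOrder (_≟_ : DecidableEquality X) {_≤_ : X → X → Bool} (lo : IsLinearOrder _≤_) where
  open IsLinearOrder lo renaming (trans to ≤-trans)

  _<_ : X → X → Bool
  _<_ = strict _≟_ _≤_

  ≤-refl : ∀ a → a ≤ a ≡ true
  ≤-refl a = proj₁ (Equivalence.from (antisym a a) refl)

  <-irrefl : ∀ a → a < a ≡ false
  <-irrefl a rewrite ⌊⌋-true (a ≟ a) refl = ∧-zeroʳ (a ≤ a)

  <⇒≤ : ∀ {a b} → a < b ≡ true → a ≤ b ≡ true
  <⇒≤ {a} = ∧-conicalˡ (a ≤ _) _

  <⇒≢ : ∀ {a b} → a < b ≡ true → a ≢ b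
  <⇒≢ {a} a<a refl = true≢false (trans (sym a<a) (<-irrefl a))

  ≤∧≢⇒< : ∀ {a b} → a ≤ b ≡ true → a ≢ b → a < b ≡ true
  ≤∧≢⇒< {a} {b} a≤b a≢b rewrite ⌊⌋-false (a ≟ b) a≢b = ∧-true a≤b refl

  ≤-<-trans : ∀ {a b c} → a ≤ b ≡ true → b < c ≡ true → a < c ≡ true
  ≤-<-trans {a} {b} {c} a≤b b<c = ≤∧≢⇒< (≤-trans a b c a≤b (<⇒≤ b<c))
    λ { refl → <⇒≢ b<c (Equivalence.to (antisym b a) (<⇒≤ b<c , a≤b)) }

  <-isStrictTotal : IsStrictTotal _<_
  <-isStrictTotal = record
    { irrefl = <-irrefl ; transitive = ≤-<-trans ∘ <⇒≤ ; trichotomous = <-trichotomous }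
    where
    <-trichotomous : ∀ a b → a < b ≡ true ⊎ a ≡ b ⊎ b < a ≡ true
    <-trichotomous a b = case a ≟ b of λ
      { (yes a≡b) → inj₂ (inj₁ a≡b)
      ; (no a≢b)  → [ (λ a≤b → inj₁ (≤∧≢⇒< a≤b a≢b))
                    , (λ b≤a → inj₂ (inj₂ (≤∧≢⇒< b≤a (a≢b ∘ sym))))
                    ]′ (total a b)
      }

  ≤-maxˡ : ∀ a b → a ≤ maxOf _≤_ a b ≡ true
  ≤-maxˡ a b with a ≤ b in a≤b
  ... | true  = a≤b
  ... | false = ≤-refl a

  ≤-maxʳ : ∀ a b → b ≤ maxOf _≤_ a b ≡ true
  ≤-maxʳ a b with a ≤ b in a≰b
  ... | true  = ≤-refl b
  ... | false = [ (λ a≤b → contradiction (trans (sym a≤b) a≰b) true≢false) , (λ b≤a → b≤a) ]′ (total a b)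

  hasLeast-<⇒≤ : ∀ m → HasLeast _<_ (λ a → a < m ≡ true) → HasLeast _<_ (λ a → a ≤ m ≡ true)
  hasLeast-<⇒≤ m least R with least R | R m in Rm
  ... | inj₂ (x , x<m , Rx , minimal) | _ =
    inj₂ (x , <⇒≤ x<m , Rx , λ y _ y<x → minimal y (≤-<-trans (<⇒≤ y<x) x<m) y<x)
  ... | inj₁ none | true  = inj₂ (m , ≤-refl m , Rm , λ y _ → none y)
  ... | inj₁ none | false = inj₁ λ y y≤m → case y ≟ m of λ
    { (yes refl) → Rm
    ; (no y≢m)   → none y (≤∧≢⇒< y≤m y≢m)
    }

isWellOrder⇒hasLeast : {_≟_ : DecidableEquality X} {_≤_ : X → X → Bool} →
  IsWellOrder X _≟_ _≤_ → HasLeast (strict _≟_ _≤_) U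
isWellOrder⇒hasLeast {X = X} {_≟_} {_≤_} (lo , (isEmpty , isEmpty-spec) , downClosed) R =
  least (downClosed NoneBelow noneBelow-downClosed)
  where
  open IsLinearOrder lo renaming (trans to ≤-trans)
  open LinearOrder _≟_ lo

  -- The least witness of R is the bound b of the initial segment NoneBelow = (#<b).
  NoneBelow : X → Bool
  NoneBelow a = isEmpty (λ c → c ≤ a ∧ R c)

  noneBelow-sound : ∀ {a} → NoneBelow a ≡ true → ∀ c → c ≤ a ≡ true → R c ≡ false
  noneBelow-sound {a} h c c≤a =
    subst (λ b → b ∧ R c ≡ false) c≤a (Equivalence.to (isEmpty-spec _) h c)

  noneBelow-complete : ∀ {a} → (∀ c → c ≤ a ≡ true → R c ≡ false) → NoneBelow a ≡ true
  noneBelow-complete {a} h = Equivalence.from (isEmpty-spec _) λ c → witness-false c (c ≤ a) refl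
    where
    witness-false : ∀ c b → c ≤ a ≡ b → b ∧ R c ≡ false
    witness-false c true  c≤a = h c c≤a
    witness-false c false _   = refl

  noneBelow-downClosed : DownClosed _≤_ NoneBelow
  noneBelow-downClosed a b h a≤b = noneBelow-complete λ c c≤a → noneBelow-sound h c (≤-trans c a b c≤a a≤b)

  least : (∀ a → NoneBelow a ≡ true) ⊎ (∃ λ b → ∀ a → NoneBelow a ≡ a < b) →
          FalseOn U R ⊎ ∃ (MinimalIn _<_ U R)
  least (inj₁ all) = inj₁ λ x _ → noneBelow-sound (all x) x (≤-refl x)
  least (inj₂ (b , NoneBelow≗<b)) = inj₂ (b , tt , Rb , λ y _ y<b → R-false y (trans (NoneBelow≗<b y) y<b))
    where
    R-false : ∀ y → NoneBelow y ≡ true → R y ≡ false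
    R-false y h = noneBelow-sound h y (≤-refl y)

    Rb : R b ≡ true
    Rb with R b in Rb≡
    ... | true  = refl
    ... | false = contradiction
      (trans (sym (noneBelow-complete below-b)) (trans (NoneBelow≗<b b) (<-irrefl b))) true≢false
      where
      below-b : ∀ c → c ≤ b ≡ true → R c ≡ false
      below-b c c≤b with c ≟ b
      ... | yes refl = Rb≡
      ... | no c≢b   = R-false c (trans (NoneBelow≗<b c) (≤∧≢⇒< c≤b c≢b))

hasLeast⇒isWellOrder : {_≟_ : DecidableEquality X} {_≤_ : X → X → Bool} →
  IsLinearOrder _≤_ → HasLeast (strict _≟_ _≤_) U → IsWellOrder X _≟_ _≤_
hasLeast⇒isWellOrder {X = X} {_≟_} {_≤_} lo least = lo , (isEmpty , isEmpty-spec) , downClosed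
  where
  open IsLinearOrder lo using (total)
  open LinearOrder _≟_ lo using (_<_; ≤∧≢⇒<)

  isEmpty : (X → Bool) → Bool
  isEmpty R = is-inj₁ (least R)

  isEmpty-spec : ∀ R → (isEmpty R ≡ true) ⇔ (∀ x → R x ≡ false)
  isEmpty-spec R = mk⇔ (λ h x → is-inj₁-true (least R) h x tt) (complete (least R))
    where
    complete : (s : FalseOn U R ⊎ ∃ (MinimalIn _<_ U R)) → (∀ x → R x ≡ false) → is-inj₁ s ≡ true
    complete (inj₁ _)                none = refl
    complete (inj₂ (x , _ , Rx , _)) none = contradiction (trans (sym Rx) (none x)) true≢false

  downClosed : ∀ D → DownClosed _≤_ D → (∀ a → D a ≡ true) ⊎ (∃ λ b → ∀ a → D a ≡ a < b)
  downClosed D D-downClosed with least (not ∘ D)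
  ... | inj₁ none = inj₁ λ a → not-injective (none a tt)
  ... | inj₂ (b , _ , ¬Db , minimal) = inj₂ (b , λ a → true⇔true⇒≡ (D⇒< a) (<⇒D a))
    where
    Db≢true : D b ≢ true
    Db≢true Db = true≢false (trans (sym Db) (not-injective ¬Db))

    D⇒< : ∀ a → D a ≡ true → a < b ≡ true
    D⇒< a Da with total a b
    ... | inj₂ b≤a = contradiction (D-downClosed b a Da b≤a) Db≢true
    ... | inj₁ a≤b = ≤∧≢⇒< a≤b λ { refl → Db≢true Da }

    <⇒D : ∀ a → a < b ≡ true → D a ≡ true
    <⇒D a a<b = not-injective (minimal a tt a<b)

-- The canonical order

module CanonicalOrder {A : Set} (_≟_ : DecidableEquality A) (_≤_ : A → A → Bool) (B : A → Bool)
  (lo : IsLinearOrder _≤_) where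
  open IsLinearOrder lo renaming (trans to ≤-trans)
  open LinearOrder _≟_ lo
  module Lex₂ = Lex _≟_ _<_ _<_
  module Lex₃ = Lex _≟_ _<_ Lex₂._<_

  P : Set
  P = A × Sub A B

  _≟ᶜ_ : DecidableEquality P
  _≟ᶜ_ = prodDecEq _≟_ B

  _<ᶜ_ _≤ᶜ_ : P → P → Bool
  _<ᶜ_ = canLt _≟_ _≤_ B
  _≤ᶜ_ = canLe _≟_ _≤_ B

  open ReflClosure _≟ᶜ_ using (strict-≤; isLinearOrder)

  InSegment : P → P → Bool
  InSegment p q = strict _≟ᶜ_ _≤ᶜ_ q p

  -- _<ᶜ_ is, definitionally, the lexicographic order on these triples.
  key : P → A × A × A
  key (a , b) = maxOf _≤_ a (proj₁ b) , a , proj₁ b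

  key-injective : Injective _≡_ _≡_ key
  key-injective {a , _} refl = cong (a ,_) (Sub-≡ refl)

  key-fibre : ∀ p {c a b} → key p ≡ (c , a , b) → c ≡ maxOf _≤_ a b × B b ≡ true
  key-fibre (_ , _ , Bb) refl = refl , Bb

  key-image? : ∀ t → Dec (∃ λ p → key p ≡ t)
  key-image? (c , a , b) with B b in Bb | c ≟ maxOf _≤_ a b
  ... | true  | yes refl = yes ((a , b , Bb) , refl)
  ... | true  | no c≢m   = no λ (p , key≡) → c≢m (proj₁ (key-fibre p key≡))
  ... | false | _        = no λ (p , key≡) → true≢false (trans (sym (proj₂ (key-fibre p key≡))) Bb)

  <ᶜ-isStrictTotal : IsStrictTotal _<ᶜ_
  <ᶜ-isStrictTotal = on-isStrictTotal key key-injective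
    (Lex₃.lex-isStrictTotal <-isStrictTotal (Lex₂.lex-isStrictTotal <-isStrictTotal <-isStrictTotal))

  ≤ᶜ-isLinearOrder : IsLinearOrder _≤ᶜ_
  ≤ᶜ-isLinearOrder = isLinearOrder <ᶜ-isStrictTotal

  maxKey : P → A
  maxKey = proj₁ ∘ key

  <ᶜ⇒maxKey≤ : ∀ q p → q <ᶜ p ≡ true → maxKey q ≤ maxKey p ≡ true
  <ᶜ⇒maxKey≤ q p q<p with Lex₃.lex-cases (key q) (key p) q<p
  ... | inj₁ mq<mp       = <⇒≤ mq<mp
  ... | inj₂ (mq≡mp , _) = subst (λ m → maxKey q ≤ m ≡ true) mq≡mp (≤-refl (maxKey q))

  Box : A → A × A × A → Set
  Box m = Below ⟨×⟩ Below ⟨×⟩ Below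
    where
    Below : A → Set
    Below a = a ≤ m ≡ true

  key-inBox : ∀ {m} q → maxKey q ≤ m ≡ true → Box m (key q)
  key-inBox (a , b , _) mq≤m =
    mq≤m , ≤-trans _ _ _ (≤-maxˡ a b) mq≤m , ≤-trans _ _ _ (≤-maxʳ a b) mq≤m

  module _ (awo : IsAlmostWellOrder A _≟_ _≤_) where

    hasLeast-≤ : ∀ m → HasLeast _<_ (λ a → a ≤ m ≡ true)
    hasLeast-≤ m = hasLeast-<⇒≤ m (hasLeast-fromSub
      (hasLeast-resp (strict-induced _≟_ _≤_ _) (isWellOrder⇒hasLeast (proj₂ awo m))))

    hasLeast-box : ∀ m → HasLeast Lex₃._<_ (Box m)
    hasLeast-box m = Lex₃.hasLeast-lex (hasLeast-≤ m) (Lex₂.hasLeast-lex (hasLeast-≤ m) (hasLeast-≤ m))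

    hasLeast-segment : ∀ p → HasLeast _<ᶜ_ (λ q → InSegment p q ≡ true)
    hasLeast-segment p = hasLeast-⊆ (InSegment p)
      (λ q q<p → key-inBox q (<ᶜ⇒maxKey≤ q p (trans (sym (strict-≤ <ᶜ-isStrictTotal q p)) q<p)))
      (hasLeast-on key key-injective key-image? (hasLeast-box (maxKey p)))

    segment-isWellOrder : ∀ p →
      IsWellOrder (Seg _≟ᶜ_ _≤ᶜ_ p) (subDecEq _≟ᶜ_ (InSegment p)) (induced _≤ᶜ_ (InSegment p))
    segment-isWellOrder p = hasLeast⇒isWellOrder (induced-isLinearOrder ≤ᶜ-isLinearOrder _)
      (hasLeast-resp (λ u v → sym (strict-induced _≟ᶜ_ _≤ᶜ_ _ u v))
        (hasLeast-toSub (hasLeast-resp (λ q q′ → sym (strict-≤ <ᶜ-isStrictTotal q q′))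
          (hasLeast-segment p))))

mainTheorem16 : (A : Set) (_≟_ : DecidableEquality A) (_≤_ : A → A → Bool) (B : A → Bool) →
    IsLinearOrder _≤_ →
    IsAlmostWellOrder A _≟_ _≤_ →
    IsAlmostWellOrder (Sub A B) (subDecEq _≟_ B) (induced _≤_ B) →
    IsAlmostWellOrder (A × Sub A B) (prodDecEq _≟_ B) (canLe _≟_ _≤_ B)
mainTheorem16 A _≟_ _≤_ B lo awoA _ = ≤ᶜ-isLinearOrder , segment-isWellOrder awoA
  where open CanonicalOrder _≟_ _≤_ B lo
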